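{- Let $m,t\in\mathbb{N}$, let $C$ be the cycle $C_{2m+1}$, let $K=K_{1,t}$ with parts $X=\{x\}$ and $Y=\{y_q:q\in[t]\}$, let $M=C\square K$, and let $\mathcal{H}$ be a $3$-fold cover of $M$. Then for each $q\in[t]$, at most $3$ $\mathcal{H}_X$-colorings of $M_X$ are volatile for $M_{y_q}$.
   Context: A cover of a graph $G$ is a pair $\mathcal{H}=(L,H)$ with $H$ a graph and $L:V(G)\to\mathcal{P}(V(H))$ such that $\{L(v)\}$ partitions $V(H)$ into $|V(G)|$ parts, each $H[L(v)]$ is complete, edges of $H$ between distinct $L(u),L(v)$ occur only if $uv\in E(G)$, and for $uv\in E(G)$ these edges form a (possibly empty) matching; $3$-fold means all $|L(v)|=3$. An $\mathcal{H}$-coloring of $G$ is an independent set $I$ of $H$ with $|I\cap L(v)|=1$ for all $v$. $\square$ is the Cartesian product. Notation: $M_X=M[V(C)\times X]$, $M_{y_q}=M[V(C)\times\{y_q\}]$; $\mathcal{H}_X$ and $\mathcal{H}_{y_q}=(L_{y_q},H_{y_q})$ are the subcovers induced by $V(C)\times X$ and $V(C)\times\{y_q\}$ (restrict $L$ and take the induced subgraph of $H$ on the union of the corresponding lists). Given an $\mathcal{H}_X$-coloring $I$ of $M_X$, let $D_q=\{u\in V(H_{y_q}): N_H(u)\cap I=\emptyset\}$, $L'_{y_q}(w)=L_{y_q}(w)\cap D_q$, $\mathcal{H}'_{y_q}=(L'_{y_q},H[D_q])$. $I$ is volatile for $M_{y_q}$ if there is no independent set of $H[D_q]$ meeting each $L'_{y_q}(w)$,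 $w\in V(M_{y_q})$, in exactly one vertex. -}

module Defs where

open import Data.Nat using (ℕ; zero; suc; _+_; _*_; _≤_)
open import Data.Fin using (Fin; toℕ) renaming (zero to fzero; suc to fsuc)
open import Data.Product using (_×_; _,_; Σ; ∃)
open import Data.Sum using (_⊎_)
open import Relation.Nullary using (¬_)
open import Relation.Binary.PropositionalEquality using (_≡_; _≢_)

-- Cycle C_n on vertex set Fin n (meaningful for n ≥ 3): i ~ j iff j = i+1 mod n or i = j+1 mod n.
CycleAdj : (n : ℕ) → Fin n → Fin n → Set
CycleAdj n i j =
  (suc (toℕ i) ≡ toℕ j) ⊎ (suc (toℕ j) ≡ toℕ i)
  ⊎ ((toℕ i ≡ 0) × (suc (toℕ j) ≡ n)) ⊎ ((toℕ j ≡ 0) × (suc (toℕ i) ≡ n))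

-- Star K_{1,t} on Fin (suc t): fzero is the centre x, fsuc q is the leaf y_q.
StarAdj : (t : ℕ) → Fin (suc t) → Fin (suc t) → Set
StarAdj t a b = ((a ≡ fzero) × (b ≢ fzero)) ⊎ ((b ≡ fzero) × (a ≢ fzero))

BoxAdj : {A B : Set} → (A → A → Set) → (B → B → Set) → A × B → A × B → Set
BoxAdj RA RB (a , b) (a' , b') = ((b ≡ b') × RA a a') ⊎ ((a ≡ a') × RB b b')

MV : ℕ → ℕ → Set
MV m t = Fin (2 * m + 1) × Fin (suc t)

MAdj : (m t : ℕ) → MV m t → MV m t → Set
MAdj m t = BoxAdj (CycleAdj (2 * m + 1)) (StarAdj t)

-- A 3-fold cover (L, H) of a graph (V, Adj).  WLOG (up to isomorphism of covers)
-- V(H) = V × Fin 3 and L(v) = {v} × Fin 3.  E is the edge relation of H.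
record Cover3 (V : Set) (Adj : V → V → Set) : Set₁ where
  field
    E        : V × Fin 3 → V × Fin 3 → Set
    E-sym    : ∀ p q → E p q → E q p
    E-irrefl : ∀ p → ¬ E p p
    E-clique : ∀ v k k' → k ≢ k' → E (v , k) (v , k')
    E-cross  : ∀ u v k k' → u ≢ v → E (u , k) (v , k') → Adj u v
    E-match  : ∀ u v k k₁ k₂ → u ≢ v → E (u , k) (v , k₁) → E (u , k) (v , k₂) → k₁ ≡ k₂

module _ (m t : ℕ) (𝓗 : Cover3 (MV m t) (MAdj m t)) where
  open Cover3 𝓗

  -- An 𝓗_X-colouring of M_X (V(M_X) = V(C) × {x}): an independent set of H_X
  -- meeting each list in exactly one vertex, encoded by the chosen colour index.
  IsHXColoring : (Fin (2 * m + 1) → Fin 3) → Set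
  IsHXColoring c = ∀ i j → ¬ E ((i , fzero) , c i) ((j , fzero) , c j)

  InD : (c : Fin (2 * m + 1) → Fin 3) (q : Fin t) → Fin (2 * m + 1) → Fin 3 → Set
  InD c q i k = ∀ j → ¬ E ((i , fsuc q) , k) ((j , fzero) , c j)

  Volatile : (c : Fin (2 * m + 1) → Fin 3) (q : Fin t) → Set
  Volatile c q =
    ¬ (Σ (Fin (2 * m + 1) → Fin 3) λ d →
         (∀ i → InD c q i (d i)) ×
         (∀ i j → ¬ E ((i , fsuc q) , d i) ((j , fsuc q) , d j)))

module Submission where

-- Delete from the layer H_{y_q} the neighbours of an 𝓗_X-colouring I: over each cycle vertex at most
-- one colour disappears (the one matched to I's vertex below it), and the remaining edges of the
-- layer are matchings between consecutive lists.  Greedy colouring around the cycle can therefore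
-- only get stuck at its last vertex p, so if I is volatile, every colour available at p + 1 is
-- matched to a colour available at p.  If two volatile colourings agree at p but differ at p + 1,
-- every colour at p + 1 is available for one of them; the three colours at p + 1 then have three
-- distinct available partners at p, so all of p's colours are available and greedy colouring ending
-- at p succeeds.  Hence volatile colourings that agree at one vertex agree everywhere, and among four
-- of them two agree at vertex 0.

open import Defs
open import Data.Nat using (ℕ; zero; suc; _+_; _*_; _<_; _≤_; s≤s)
import Data.Nat.Properties as ℕ
open import Data.Nat.GeneralisedArithmetic using (fold; fold-+)
open import Data.Fin using (Fin; zero; suc; toℕ; fromℕ; inject₁; lower₁)
open import Data.Fin.Properties
  using (_≟_; toℕ-injective; toℕ-fromℕ; toℕ-inject₁; toℕ-lower₁; inject₁-lower₁; inject₁ℕ<; toℕ≤pred[n];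
         any?; ¬∀⟶∃¬; ∀-cons; <⇒≢; pigeonhole; <⇒notInjective; punchOut-injective)
open import Data.Product using (Σ; ∃; _×_; _,_; proj₁; proj₂)
open import Data.Sum using (_⊎_; inj₁; inj₂; [_,_])
open import Data.Empty using (⊥; ⊥-elim)
open import Function using (_∘_; const; Injective)
open import Relation.Nullary using (¬_; Dec; yes; no; ¬?; contradiction)
open import Relation.Nullary.Decidable using (_×-dec_; _→-dec_; decidable-stable; ¬¬-excluded-middle)
open import Relation.Nullary.Negation using (¬¬-map)
open import Relation.Unary using (Decidable)
open import Relation.Binary.PropositionalEquality
  using (_≡_; _≢_; refl; sym; trans; cong; subst; subst₂; ≢-sym; module ≡-Reasoning)

AtMostOne : {A : Set} → (A → Set) → Set
AtMostOne P = ∀ {a b} → P a → P b → a ≡ b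

avoid-both : {A B : Fin 3 → Set} → Decidable A → Decidable B → AtMostOne A → AtMostOne B →
             ∃ λ v → ¬ A v × ¬ B v
avoid-both {A} {B} A? B? A≤1 B≤1 with any? (λ v → ¬? (A? v) ×-dec ¬? (B? v))
... | yes avoiding = avoiding
... | no none = ⊥-elim (<⇒notInjective ℕ.≤-refl tag-injective)
  where
  covered : ∀ v → A v ⊎ B v
  covered v with A? v | B? v
  ... | yes a | _     = inj₁ a
  ... | no ¬a | yes b = inj₂ b
  ... | no ¬a | no ¬b = contradiction (v , ¬a , ¬b) none

  tag : Fin 3 → Fin 2
  tag v = [ const zero , const (suc zero) ] (covered v)

  tag-injective : Injective _≡_ _≡_ tag
  tag-injective {i} {j} with covered i | covered j
  ... | inj₁ a | inj₁ a' = λ _ → A≤1 a a'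
  ... | inj₂ b | inj₂ b' = λ _ → B≤1 b b'
  ... | inj₁ _ | inj₂ _  = λ ()
  ... | inj₂ _ | inj₁ _  = λ ()

fold-commute : {A : Set} (f g : A → A) → (∀ a → f (g a) ≡ g (f a)) →
               ∀ a k → fold (g a) f k ≡ g (fold a f k)
fold-commute f g fg≡gf a zero    = refl
fold-commute f g fg≡gf a (suc k) = trans (cong f (fold-commute f g fg≡gf a k)) (fg≡gf (fold a f k))

fold-inverse : {A : Set} (f g : A → A) → (∀ a → f (g a) ≡ a) → (∀ a → g (f a) ≡ a) →
               ∀ a k → fold (fold a g k) f k ≡ a
fold-inverse f g fg gf a zero    = refl
fold-inverse f g fg gf a (suc k) = begin
  f (fold (g (fold a g k)) f k)  ≡⟨ cong f (fold-commute f g (λ b → trans (fg b) (sym (gf b))) _ k) ⟩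
  f (g (fold (fold a g k) f k))  ≡⟨ fg _ ⟩
  fold (fold a g k) f k          ≡⟨ fold-inverse f g fg gf a k ⟩
  a                              ∎
  where open ≡-Reasoning

module _ {n : ℕ} where

  next : Fin (suc n) → Fin (suc n)
  next i with n ℕ.≟ toℕ i
  ... | yes _   = zero
  ... | no  n≢i = suc (lower₁ i n≢i)

  prev : Fin (suc n) → Fin (suc n)
  prev zero    = fromℕ n
  prev (suc i) = inject₁ i

  next-last : ∀ {i} → toℕ i ≡ n → next i ≡ zero
  next-last {i} i≡n with n ℕ.≟ toℕ i
  ... | yes _   = refl
  ... | no  n≢i = contradiction (sym i≡n) n≢i

  toℕ-next : ∀ {i} → toℕ i < n → toℕ (next i) ≡ suc (toℕ i)
  toℕ-next {i} i<n with n ℕ.≟ toℕ i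
  ... | yes n≡i = contradiction (sym n≡i) (ℕ.<⇒≢ i<n)
  ... | no  n≢i = cong suc (toℕ-lower₁ i n≢i)

  prev-next : ∀ i → prev (next i) ≡ i
  prev-next i with n ℕ.≟ toℕ i
  ... | yes n≡i = toℕ-injective (trans (toℕ-fromℕ n) n≡i)
  ... | no  n≢i = inject₁-lower₁ i n≢i

  next-prev : ∀ i → next (prev i) ≡ i
  next-prev zero    = next-last (toℕ-fromℕ n)
  next-prev (suc i) = toℕ-injective (trans (toℕ-next (inject₁ℕ< i)) (cong suc (toℕ-inject₁ i)))

  below-or-last : (i : Fin (suc n)) → toℕ i < n ⊎ toℕ i ≡ n
  below-or-last i = ℕ.m≤n⇒m<n∨m≡n (toℕ≤pred[n] i)

  toℕ-fold-next : ∀ k → k ≤ n → toℕ (fold zero next k) ≡ k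
  toℕ-fold-next zero    _   = refl
  toℕ-fold-next (suc k) k<n = trans (toℕ-next (subst (_< n) (sym ih) k<n)) (cong suc ih)
    where
    ih : toℕ (fold zero next k) ≡ k
    ih = toℕ-fold-next k (ℕ.<⇒≤ k<n)

  fold-next-zero : ∀ i → fold zero next (toℕ i) ≡ i
  fold-next-zero i = toℕ-injective (toℕ-fold-next (toℕ i) (toℕ≤pred[n] i))

  successor⇒next : ∀ {i j} → suc (toℕ i) ≡ toℕ j → j ≡ next i
  successor⇒next {i} {j} 1+i≡j =
    toℕ-injective (trans (sym 1+i≡j) (sym (toℕ-next (subst (_≤ n) (sym 1+i≡j) (toℕ≤pred[n] j)))))

  wrap⇒next : ∀ {i j} → toℕ j ≡ 0 → suc (toℕ i) ≡ suc n → j ≡ next i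
  wrap⇒next {i} {j} j≡0 1+i≡1+n = trans (toℕ-injective {j = zero} j≡0) (sym (next-last (ℕ.suc-injective 1+i≡1+n)))

  cycleAdj⇒next : ∀ {i j} → CycleAdj (suc n) i j → j ≡ next i ⊎ i ≡ next j
  cycleAdj⇒next (inj₁ 1+i≡j)                        = inj₁ (successor⇒next 1+i≡j)
  cycleAdj⇒next (inj₂ (inj₁ 1+j≡i))                 = inj₂ (successor⇒next 1+j≡i)
  cycleAdj⇒next (inj₂ (inj₂ (inj₁ (i≡0 , 1+j≡N))))  = inj₂ (wrap⇒next i≡0 1+j≡N)
  cycleAdj⇒next (inj₂ (inj₂ (inj₂ (j≡0 , 1+i≡N))))  = inj₁ (wrap⇒next j≡0 1+i≡N)

next≢ : ∀ {n} (i : Fin (suc (suc n))) → next i ≢ i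
next≢ {n} i next≡i with below-or-last i
... | inj₁ i<n = ℕ.1+n≢n (trans (sym (toℕ-next i<n)) (cong toℕ next≡i))
... | inj₂ i≡n = ℕ.1+n≢0 (trans (sym i≡n) (cong toℕ (trans (sym next≡i) (next-last i≡n))))

prev≢ : ∀ {n} (i : Fin (suc (suc n))) → prev i ≢ i
prev≢ i prev≡i = next≢ (prev i) (trans (next-prev i) (sym prev≡i))

module _ {n : ℕ} {K : Set}
  (D : Fin (suc (suc n)) → K → Set)
  (F : Fin (suc (suc n)) → K → Fin (suc (suc n)) → K → Set)
  (F-sym : ∀ {i a j b} → F i a j b → F j b i a)
  (F-irrefl : ∀ {i a} → ¬ F i a i a)
  (F-local : ∀ {i a j b} → F i a j b → i ≡ j ⊎ j ≡ next i ⊎ i ≡ next j)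
  where

  -- Greedy colouring along next p, next (next p), …, ending at p, whose two neighbours are coloured
  -- by then: that is the one step `close` is needed for.
  cycle-colouring : (p : Fin (suc (suc n))) (u : K) → D (next p) u →
    (∀ j a → Σ K λ b → D (next j) b × ¬ F (next j) b j a) →
    (∀ a → Σ K λ b → D p b × ¬ F p b (prev p) a × ¬ F p b (next p) u) →
    Σ (Fin (suc (suc n)) → K) λ d → (∀ j → D j (d j)) × (∀ i j → ¬ F i (d i) j (d j))
  cycle-colouring p u Du extend close = d , d-valid , d-proper
    where
    r : ℕ
    r = toℕ p

    walk : ℕ → Fin (suc (suc n))
    walk k = fold p next k

    index : Fin (suc (suc n)) → ℕ
    index j = toℕ (fold j prev r)

    walk-index : ∀ j → walk (index j) ≡ j
    walk-index j = begin
      fold p next k                   ≡⟨ cong (λ z → fold z next k) (sym (fold-next-zero p)) ⟩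
      fold (fold zero next r) next k  ≡⟨ sym (fold-+ zero next k) ⟩
      fold zero next (k + r)          ≡⟨ cong (fold zero next) (ℕ.+-comm k r) ⟩
      fold zero next (r + k)          ≡⟨ fold-+ zero next r ⟩
      fold (fold zero next k) next r  ≡⟨ cong (λ z → fold z next r) (fold-next-zero (fold j prev r)) ⟩
      fold (fold j prev r) next r     ≡⟨ fold-inverse next prev next-prev prev-next j r ⟩
      j                               ∎
      where
      open ≡-Reasoning
      k : ℕ
      k = index j

    index-next : ∀ j → (index j < suc n × index (next j) ≡ suc (index j))
                     ⊎ (index j ≡ suc n × index (next j) ≡ 0)
    index-next j rewrite fold-commute prev next (λ a → trans (prev-next a) (sym (next-prev a))) j r
      with below-or-last (fold j prev r)
    ... | inj₁ below = inj₁ (below , toℕ-next below)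
    ... | inj₂ last  = inj₂ (last , cong toℕ (next-last last))

    index-prev : index (prev p) ≡ suc n
    index-prev = begin
      toℕ (fold (prev p) prev r)                   ≡⟨ cong toℕ (fold-commute prev prev (λ _ → refl) p r) ⟩
      toℕ (prev (fold p prev r))                   ≡⟨ cong (λ z → toℕ (prev (fold z prev r)))
                                                           (sym (fold-next-zero p)) ⟩
      toℕ (prev (fold (fold zero next r) prev r))  ≡⟨ cong (toℕ ∘ prev)
                                                           (fold-inverse prev next prev-next next-prev zero r) ⟩
      toℕ (prev {suc n} zero)                      ≡⟨ toℕ-fromℕ (suc n) ⟩
      suc n                                        ∎
      where open ≡-Reasoning

    path : ℕ → K
    path zero    = u
    path (suc k) = proj₁ (extend (walk (suc k)) (path k))

    path-valid : ∀ k → D (walk (suc k)) (path k)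
    path-valid zero    = Du
    path-valid (suc k) = proj₁ (proj₂ (extend (walk (suc k)) (path k)))

    closing : Σ K λ b → D p b × ¬ F p b (prev p) (path n) × ¬ F p b (next p) u
    closing = close (path n)

    colour : ℕ → K
    colour zero    = proj₁ closing
    colour (suc k) = path k

    colour-valid : ∀ k → D (walk k) (colour k)
    colour-valid zero    = proj₁ (proj₂ closing)
    colour-valid (suc k) = path-valid k

    colour-step : ∀ k → ¬ F (walk k) (colour k) (walk (suc k)) (colour (suc k))
    colour-step zero    = proj₂ (proj₂ (proj₂ closing))
    colour-step (suc k) = proj₂ (proj₂ (extend (walk (suc k)) (path k))) ∘ F-sym

    colour-wrap : ¬ F (walk (suc n)) (colour (suc n)) (walk zero) (colour zero)
    colour-wrap = subst (λ z → ¬ F z (path n) p (proj₁ closing))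
                        (trans (sym (walk-index (prev p))) (cong walk index-prev))
                        (proj₁ (proj₂ (proj₂ closing)) ∘ F-sym)

    d : Fin (suc (suc n)) → K
    d j = colour (index j)

    d-valid : ∀ j → D j (d j)
    d-valid j = subst (λ i → D i (d j)) (walk-index j) (colour-valid (index j))

    proper-at : ∀ {i i' k k'} → index i ≡ k → index i' ≡ k' →
                ¬ F (walk k) (colour k) (walk k') (colour k') → ¬ F i (d i) i' (d i')
    proper-at {i} {i'} refl refl = subst₂ (λ a b → ¬ F a (d i) b (d i')) (walk-index i) (walk-index i')

    proper-next : ∀ j → ¬ F j (d j) (next j) (d (next j))
    proper-next j with index-next j
    ... | inj₁ (_ , step)    = proper-at refl step (colour-step (index j))
    ... | inj₂ (last , wrap) = proper-at last wrap colour-wrap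

    d-proper : ∀ i j → ¬ F i (d i) j (d j)
    d-proper i j f with F-local f
    ... | inj₁ refl        = F-irrefl f
    ... | inj₂ (inj₁ refl) = proper-next i f
    ... | inj₂ (inj₂ refl) = proper-next j (F-sym f)

injective-avoiding⇒empty : ∀ {m} {A : Fin (suc m) → Set} (f : Fin (suc m) → Fin (suc m)) →
                           Injective _≡_ _≡_ f → (∀ u → ¬ A (f u)) → ∀ v → ¬ A v
injective-avoiding⇒empty f f-injective avoids v Av =
  <⇒notInjective ℕ.≤-refl (f-injective ∘ punchOut-injective (v≢f _) (v≢f _))
  where
  v≢f : ∀ u → v ≢ f u
  v≢f u refl = avoids u Av

DoubleNegationShift : Set → Set₁
DoubleNegationShift A = {P : A → Set} → (∀ a → ¬ ¬ P a) → ¬ ¬ (∀ a → P a)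

doubleNegationShift-Fin : ∀ k → DoubleNegationShift (Fin k)
doubleNegationShift-Fin zero    _     ¬all = ¬all λ ()
doubleNegationShift-Fin (suc k) ¬¬Pᵢ ¬all =
  ¬¬Pᵢ zero λ P₀ → doubleNegationShift-Fin k (¬¬Pᵢ ∘ suc) λ Pₛ → ¬all (∀-cons P₀ Pₛ)

doubleNegationShift-× : {A B : Set} → DoubleNegationShift A → DoubleNegationShift B →
                        DoubleNegationShift (A × B)
doubleNegationShift-× shiftA shiftB ¬¬P ¬all =
  shiftA (λ a → shiftB (λ b → ¬¬P (a , b))) λ P → ¬all λ (a , b) → P a b

¬¬-decidable : {A : Set} → DoubleNegationShift A → (R : A → A → Set) → ¬ ¬ (∀ a b → Dec (R a b))
¬¬-decidable shift R = shift λ a → shift λ b → ¬¬-excluded-middle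

-- ¬ Extendable 𝓗 q c is Defs' Volatile, for a cycle of any length N.
module _ {N t : ℕ} (𝓗 : Cover3 (Fin N × Fin (suc t)) (BoxAdj (CycleAdj N) (StarAdj t))) (q : Fin t) where
  open Cover3 𝓗

  Extendable : (Fin N → Fin 3) → Set
  Extendable c =
    Σ (Fin N → Fin 3) λ d →
      (∀ i j → ¬ E ((i , suc q) , d i) ((j , zero) , c j)) ×
      (∀ i j → ¬ E ((i , suc q) , d i) ((j , suc q) , d j))

module VolatileColourings {n t : ℕ}
  (𝓗 : Cover3 (Fin (suc (suc n)) × Fin (suc t)) (BoxAdj (CycleAdj (suc (suc n))) (StarAdj t)))
  (q : Fin t) where
  open Cover3 𝓗

  C : Set
  C = Fin (suc (suc n))

  x y : Fin (suc t)
  x = zero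
  y = suc q

  -- k ∉ L′_{y_q}(i); by `unblocked⇒free` the only possible I-neighbour of (i , y_q , k) lies over i.
  Blocked : (C → Fin 3) → C → Fin 3 → Set
  Blocked c i k = E ((i , y) , k) ((i , x) , c i)

  YEdge : C → Fin 3 → C → Fin 3 → Set
  YEdge i a j b = E ((i , y) , a) ((j , y) , b)

  blocked-unique : ∀ c i → AtMostOne (Blocked c i)
  blocked-unique c i b₁ b₂ = E-match _ _ _ _ _ (λ ()) (E-sym _ _ b₁) (E-sym _ _ b₂)

  yedge-unique : ∀ {i j} b → i ≢ j → AtMostOne (λ a → YEdge i a j b)
  yedge-unique b i≢j e₁ e₂ = E-match _ _ _ _ _ (i≢j ∘ sym ∘ cong proj₁) (E-sym _ _ e₁) (E-sym _ _ e₂)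

  yedge-local : ∀ {i a j b} → YEdge i a j b → i ≡ j ⊎ j ≡ next i ⊎ i ≡ next j
  yedge-local {i} {j = j} e with i ≟ j
  ... | yes i≡j = inj₁ i≡j
  ... | no  i≢j with E-cross _ _ _ _ (i≢j ∘ cong proj₁) e
  ...   | inj₁ (_ , adjacent) = inj₂ (cycleAdj⇒next adjacent)
  ...   | inj₂ (i≡j , _)      = contradiction i≡j i≢j

  unblocked⇒free : ∀ {c i k} → ¬ Blocked c i k → ∀ j → ¬ E ((i , y) , k) ((j , x) , c j)
  unblocked⇒free {i = i} ¬blocked j e with i ≟ j
  ... | yes refl = ¬blocked e
  ... | no  i≢j with E-cross _ _ _ _ (i≢j ∘ cong proj₁) e
  ...   | inj₁ (() , _)
  ...   | inj₂ (i≡j , _) = i≢j i≡j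

  module _ (E? : ∀ a b → Dec (E a b)) where

    free-colour : ∀ c i {A : Fin 3 → Set} → Decidable A → AtMostOne A → ∃ λ v → ¬ Blocked c i v × ¬ A v
    free-colour c i A? A≤1 = avoid-both (λ _ → E? _ _) A? (blocked-unique c i) A≤1

    unblocked-colour : ∀ c i → ∃ λ v → ¬ Blocked c i v
    unblocked-colour c i =
      let v , ¬blocked , _ = free-colour c i {λ _ → ⊥} (λ _ → no λ ()) (λ ()) in v , ¬blocked

    extendable-around : ∀ c p u → ¬ Blocked c (next p) u →
      (∀ w → ∃ λ v → ¬ Blocked c p v × ¬ YEdge p v (prev p) w × ¬ YEdge p v (next p) u) →
      Extendable 𝓗 q c
    extendable-around c p u unblocked close =
      let d , d-unblocked , d-proper = cycle-colouring (λ i v → ¬ Blocked c i v) YEdge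
                                         (E-sym _ _) (E-irrefl _) yedge-local p u unblocked extend close
      in d , (λ i → unblocked⇒free (d-unblocked i)) , d-proper
      where
      extend : ∀ j a → ∃ λ b → ¬ Blocked c (next j) b × ¬ YEdge (next j) b j a
      extend j a = free-colour c (next j) (λ _ → E? _ _) (yedge-unique a (next≢ j))

    volatile⇒matched : ∀ {c} → ¬ Extendable 𝓗 q c → ∀ p {u} → ¬ Blocked c (next p) u →
                       ∃ λ v → ¬ Blocked c p v × YEdge (next p) u p v
    volatile⇒matched {c} volatile p {u} unblocked =
      matched (¬∀⟶∃¬ 3 Unmatched (λ _ → ¬? (E? _ _) →-dec ¬? (E? _ _))
                                 (volatile ∘ extendable-around c p u unblocked ∘ close))
      where
      Unmatched : Fin 3 → Set
      Unmatched v = ¬ Blocked c p v → ¬ YEdge (next p) u p v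

      close : (∀ v → Unmatched v) →
              ∀ w → ∃ λ v → ¬ Blocked c p v × ¬ YEdge p v (prev p) w × ¬ YEdge p v (next p) u
      close unmatched w =
        let v , ¬blocked , ¬edge = free-colour c p (λ _ → E? _ _) (yedge-unique w (≢-sym (prev≢ p)))
        in v , ¬blocked , ¬edge , unmatched v ¬blocked ∘ E-sym _ _

      matched : (∃ λ v → ¬ Unmatched v) → ∃ λ v → ¬ Blocked c p v × YEdge (next p) u p v
      matched (v , ¬unmatched) =
        v , (λ blocked → ¬unmatched λ ¬blocked → contradiction blocked ¬blocked)
          , decidable-stable (E? _ _) (¬unmatched ∘ const)

    volatile-agreement-propagates : ∀ {ca cb} → ¬ Extendable 𝓗 q ca → ¬ Extendable 𝓗 q cb →
                                    ∀ p → ca p ≡ cb p → ca (next p) ≡ cb (next p)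
    volatile-agreement-propagates {ca} {cb} va vb p same with ca (next p) ≟ cb (next p)
    ... | yes same′ = same′
    -- Each colour at next p is available for ca or cb, hence has a `partner` at p that is available
    -- for ca; partners are distinct, so every colour at p is available.
    ... | no  differ = contradiction (extendable-around ca p u₀ unblocked₀ close) va
      where
      unblocked-for-one : ∀ u → ¬ Blocked ca (next p) u ⊎ ¬ Blocked cb (next p) u
      unblocked-for-one u with E? _ _ | E? _ _
      ... | no ¬blocked | _           = inj₁ ¬blocked
      ... | yes _       | no ¬blocked = inj₂ ¬blocked
      ... | yes blocked | yes blocked′ = contradiction (E-match _ _ _ _ _ (λ ()) blocked blocked′) differ

      matched : ∀ u → ∃ λ v → ¬ Blocked ca p v × YEdge (next p) u p v
      matched u with unblocked-for-one u
      ... | inj₁ ¬blocked = volatile⇒matched va p ¬blocked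
      ... | inj₂ ¬blocked = let v , ¬blocked′ , edge = volatile⇒matched vb p ¬blocked
                            in v , subst (λ γ → ¬ E ((p , y) , v) ((p , x) , γ)) (sym same) ¬blocked′ , edge

      partner : Fin 3 → Fin 3
      partner u = proj₁ (matched u)

      partner-injective : Injective _≡_ _≡_ partner
      partner-injective {u₁} {u₂} same-partner =
        E-match _ _ _ _ _ (≢-sym (next≢ p) ∘ cong proj₁) (E-sym _ _ (proj₂ (proj₂ (matched u₁))))
          (E-sym _ _ (subst (YEdge (next p) u₂ p) (sym same-partner) (proj₂ (proj₂ (matched u₂)))))

      all-unblocked : ∀ v → ¬ Blocked ca p v
      all-unblocked = injective-avoiding⇒empty partner partner-injective (proj₁ ∘ proj₂ ∘ matched)

      u₀ : Fin 3
      u₀ = proj₁ (unblocked-colour ca (next p))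

      unblocked₀ : ¬ Blocked ca (next p) u₀
      unblocked₀ = proj₂ (unblocked-colour ca (next p))

      close : ∀ w → ∃ λ v → ¬ Blocked ca p v × ¬ YEdge p v (prev p) w × ¬ YEdge p v (next p) u₀
      close w = let v , ¬edge , ¬edge′ = avoid-both (λ _ → E? _ _) (λ _ → E? _ _)
                                           (yedge-unique w (≢-sym (prev≢ p))) (yedge-unique u₀ (≢-sym (next≢ p)))
                in v , all-unblocked v , ¬edge , ¬edge′

    volatile-agree-everywhere : ∀ {ca cb} → ¬ Extendable 𝓗 q ca → ¬ Extendable 𝓗 q cb →
                                ca zero ≡ cb zero → ∀ i → ca i ≡ cb i
    volatile-agree-everywhere {ca} {cb} va vb same₀ i =
      subst (λ j → ca j ≡ cb j) (fold-next-zero i) (along (toℕ i))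
      where
      along : ∀ k → ca (fold zero next k) ≡ cb (fold zero next k)
      along zero    = same₀
      along (suc k) = volatile-agreement-propagates va vb _ (along k)

volatile-colourings-coincide :
  ∀ {N t} → 2 ≤ N → (𝓗 : Cover3 (Fin N × Fin (suc t)) (BoxAdj (CycleAdj N) (StarAdj t))) (q : Fin t) →
  (cs : Fin 4 → Fin N → Fin 3) → (∀ a → ¬ Extendable 𝓗 q (cs a)) →
  Σ (Fin 4) λ a → Σ (Fin 4) λ b → a ≢ b × (∀ i → cs a i ≡ cs b i)
volatile-colourings-coincide {N} {t} (s≤s (s≤s _)) 𝓗 q cs volatile
  with pigeonhole ℕ.≤-refl (λ a → cs a zero)
... | a , b , a<b , same-at-zero =
  a , b , <⇒≢ a<b , λ i → decidable-stable (cs a i ≟ cs b i) (¬¬-map (agree i) E-decidable)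
  where
  open Cover3 𝓗 using (E)
  open VolatileColourings 𝓗 q using (volatile-agree-everywhere)

  -- The edges of 𝓗 are not assumed decidable; being finitely many they are so under ¬ ¬, which
  -- suffices since the conclusion is decidable.
  E-decidable : ¬ ¬ (∀ v w → Dec (E v w))
  E-decidable = ¬¬-decidable (doubleNegationShift-× (doubleNegationShift-× (doubleNegationShift-Fin N)
                                                                           (doubleNegationShift-Fin (suc t)))
                                                    (doubleNegationShift-Fin 3)) E

  agree : ∀ i → (∀ v w → Dec (E v w)) → cs a i ≡ cs b i
  agree i E? = volatile-agree-everywhere E? (volatile a) (volatile b) same-at-zero i

lemma19 : (m t : ℕ) → 1 ≤ m → (𝓗 : Cover3 (MV m t) (MAdj m t)) → (q : Fin t)
    → (cs : Fin 4 → Fin (2 * m + 1) → Fin 3)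
    → (∀ a → IsHXColoring m t 𝓗 (cs a) × Volatile m t 𝓗 (cs a) q)
    → Σ (Fin 4) λ a → Σ (Fin 4) λ b → (a ≢ b) × (∀ i → cs a i ≡ cs b i)
lemma19 m t 1≤m 𝓗 q cs colourings =
  volatile-colourings-coincide (ℕ.m≤n⇒m≤n+o 1 (ℕ.*-monoʳ-≤ 2 1≤m)) 𝓗 q cs (proj₂ ∘ colourings)
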